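{- Let $m,n$ be positive integers and $k\ge 3$. Then for each $j\in\{1,\ldots,n\}$ and every $P\in U_{m,k-1}$, we have $x_j(x_j-1)\cdots(x_j-m)\cdot P\in U_{m,k}$.
   Context: $mB^n=\{0,1,\ldots,m\}^n\subseteq\mathbb{R}^n$, $\mathbf{0}$ the origin. Multiplicity of $f$ at $\mathbf{a}$: the minimum total degree of monomials in $f(\mathbf{x}+\mathbf{a})$ ($\infty$ for $f=0$). For $k\ge2$, $V_{m,k}$ is the real vector space of polynomials $P\in\mathbb{R}[x_1,\ldots,x_n]$ with $\deg P\le mn+(m+1)(k-1)-1$ such that no monomial of $P$ is divisible by $x_{i_1}^{m+1}\cdots x_{i_k}^{m+1}$ for any (not necessarily distinct) indices $i_1,\ldots,i_k$, and $U_{m,k}$ is the subspace of those $P\in V_{m,k}$ having zeros of multiplicity at least $k$ at all points of $mB^n\setminus\{\mathbf{0}\}$. -}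

module Defs where

open import Level using (Level)
open import Algebra.Bundles using (CommutativeRing)
open import Data.Nat as ℕ using (ℕ; zero; suc; _≤_; _<_)
open import Data.Fin using (Fin)
open import Data.Vec as Vec using (Vec; replicate; zipWith; lookup; _[_]≔_)
open import Data.Vec.Properties using (≡-dec)
open import Data.List as List using (List; []; _∷_; _++_; concatMap; foldr)
open import Data.Product using (_×_; _,_; ∃)
open import Relation.Nullary using (¬_; yes; no)
open import Relation.Binary.PropositionalEquality using (_≡_; _≢_)

Exp : ℕ → Set
Exp n = Vec ℕ n

totalDeg : ∀ {n} → Exp n → ℕ
totalDeg = Vec.sum

-- the monomial x_{i_1}^{m+1} ⋯ x_{i_k}^{m+1} as an exponent vector
powProdExp : ∀ {n k} → ℕ → Vec (Fin n) k → Exp n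
powProdExp {n} m Vec.[] = replicate n 0
powProdExp m (i Vec.∷ is) = powProdExp m is [ i ]≔ (suc m ℕ.+ lookup (powProdExp m is) i)

_∣ₘ_ : ∀ {n} → Exp n → Exp n → Set
_∣ₘ_ {n} β α = (i : Fin n) → lookup β i ≤ lookup α i

module Poly {c ℓ : Level} (R : CommutativeRing c ℓ) where
  open CommutativeRing R

  -- A polynomial in n variables over R: a finite formal sum of terms c·x^α.
  Pol : ℕ → Set c
  Pol n = List (Carrier × Exp n)

  coeff : ∀ {n} → Pol n → Exp n → Carrier
  coeff [] α = 0#
  coeff ((a , β) ∷ p) α with ≡-dec ℕ._≟_ β α
  ... | yes _ = a + coeff p α
  ... | no _ = coeff p α

  constP : ∀ {n} → Carrier → Pol n
  constP {n} a = (a , replicate n 0) ∷ []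

  varP : ∀ {n} → Fin n → Pol n
  varP {n} i = (1# , replicate n 0 [ i ]≔ 1) ∷ []

  _⊕_ : ∀ {n} → Pol n → Pol n → Pol n
  p ⊕ q = p ++ q

  _⊗_ : ∀ {n} → Pol n → Pol n → Pol n
  p ⊗ q = concatMap (λ { (a , α) → List.map (λ { (b , β) → (a * b , zipWith ℕ._+_ α β) }) q }) p

  powP : ∀ {n} → Pol n → ℕ → Pol n
  powP p zero = constP 1#
  powP p (suc e) = p ⊗ powP p e

  fromℕ : ℕ → Carrier
  fromℕ zero = 0#
  fromℕ (suc t) = 1# + fromℕ t

  monSubst : ∀ {n k} → Vec (Pol n) k → Vec ℕ k → Pol n
  monSubst Vec.[] Vec.[] = constP 1#
  monSubst (g Vec.∷ gs) (e Vec.∷ es) = powP g e ⊗ monSubst gs es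

  substP : ∀ {n} → Pol n → Vec (Pol n) n → Pol n
  substP p g = foldr (λ { (a , α) acc → (constP a ⊗ monSubst g α) ⊕ acc }) [] p

  shiftP : ∀ {n} → Pol n → Vec ℕ n → Pol n
  shiftP {n} p a = substP p (Vec.tabulate (λ i → varP i ⊕ constP (fromℕ (lookup a i))))

  MultAtLeast : ∀ {n} → ℕ → Pol n → Vec ℕ n → Set ℓ
  MultAtLeast k f a = ∀ α → totalDeg α < k → coeff (shiftP f a) α ≈ 0#

  fallingP : ∀ {n} → ℕ → Fin n → Pol n
  fallingP zero j = varP j
  fallingP (suc m) j = fallingP m j ⊗ (varP j ⊕ constP (- fromℕ (suc m)))

  DegAtMost : ∀ {n} → ℕ → Pol n → Set ℓ
  DegAtMost D P = ∀ α → D < totalDeg α → coeff P α ≈ 0#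

  InV : ∀ {n} → ℕ → ℕ → Pol n → Set ℓ
  InV {n} m k P =
    DegAtMost (m ℕ.* n ℕ.+ suc m ℕ.* (k ℕ.∸ 1) ℕ.∸ 1) P ×
    (∀ α → (is : Vec (Fin n) k) → powProdExp m is ∣ₘ α → coeff P α ≈ 0#)

  InGridMinus0 : ∀ {n} → ℕ → Vec ℕ n → Set
  InGridMinus0 {n} m a = ((i : Fin n) → lookup a i ≤ m) × a ≢ replicate n 0

  InU : ∀ {n} → ℕ → ℕ → Pol n → Set ℓ
  InU {n} m k P = InV m k P × (∀ a → InGridMinus0 m a → MultAtLeast k P a)

-- Write F = x_j (x_j - 1) ⋯ (x_j - m). Every monomial of F is a power x_j^t with t ≤ m + 1, so the
-- coefficient of F·P at x^α only involves coefficients of P at exponents γ with x_j^t x^γ = x^α.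
-- Such a γ has total degree at least |α| - (m + 1), and if x^α is divisible by a product of k
-- powers x_i^(m+1), then x^γ is still divisible by a product of k - 1 of them; so the degree and
-- divisibility conditions of V_{m,k} for F·P follow from those of V_{m,k-1} for P.
-- For the multiplicities: F vanishes at every grid point a because a_j ∈ {0, …, m}; translating by a
-- is multiplicative, and the product of a polynomial vanishing at a with one of multiplicity at
-- least k - 1 at a has multiplicity at least k there.

module Submission where

open import Level using (Level)
open import Algebra.Bundles using (CommutativeRing; CommutativeSemigroup)
open import Algebra.Structures using (IsCommutativeSemigroup)
import Algebra.Properties.CommutativeSemigroup as CommSemigroupProperties
open import Data.Nat using (ℕ; zero; suc; _∸_; _≤_; _<_; z≤n; s≤s)
import Data.Nat.Properties as ℕₚ
open import Data.Nat.Tactic.RingSolver using (solve-∀)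
open import Data.Fin as Fin using (Fin)
open import Data.Vec as Vec using (Vec; []; _∷_; replicate; zipWith; lookup; _[_]≔_; tabulate; count)
import Data.Vec.Properties as Vec
open import Data.List as List using ([]; _∷_)
open import Data.List.Relation.Unary.All as All using (All; []; _∷_)
import Data.List.Relation.Unary.All.Properties as All
open import Data.Product using (_×_; _,_; proj₁; proj₂; ∃)
open import Data.Sum using (_⊎_; inj₁; inj₂)
open import Data.Empty using (⊥-elim)
open import Function using (_∘_)
open import Relation.Nullary using (Dec; yes; no)
open import Relation.Binary.PropositionalEquality as ≡ using (_≡_; _≢_)
import Relation.Binary.Reasoning.Setoid as SetoidReasoning

open import Defs

module Exponents where
  open import Data.Nat using (_+_)

  infixl 6 _+ᵥ_ _∸ᵥ_
  infix 4 _≟ᵥ_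

  _+ᵥ_ : ∀ {n} → Exp n → Exp n → Exp n
  _+ᵥ_ = zipWith _+_

  _∸ᵥ_ : ∀ {n} → Exp n → Exp n → Exp n
  _∸ᵥ_ = zipWith _∸_

  0ᵥ : ∀ {n} → Exp n
  0ᵥ {n} = replicate n 0

  basis : ∀ {n} → Fin n → ℕ → Exp n
  basis {n} j t = 0ᵥ [ j ]≔ t

  _≟ᵥ_ : ∀ {n} (u v : Exp n) → Dec (u ≡ v)
  _≟ᵥ_ = Vec.≡-dec Data.Nat._≟_

  +ᵥ-comm : ∀ {n} (u v : Exp n) → u +ᵥ v ≡ v +ᵥ u
  +ᵥ-comm = Vec.zipWith-comm ℕₚ.+-comm

  +ᵥ-assoc : ∀ {n} (u v w : Exp n) → (u +ᵥ v) +ᵥ w ≡ u +ᵥ (v +ᵥ w)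
  +ᵥ-assoc = Vec.zipWith-assoc ℕₚ.+-assoc

  +ᵥ-identityˡ : ∀ {n} (u : Exp n) → 0ᵥ +ᵥ u ≡ u
  +ᵥ-identityˡ = Vec.zipWith-identityˡ ℕₚ.+-identityˡ

  u+ᵥv∸ᵥu≡v : ∀ {n} (u v : Exp n) → (u +ᵥ v) ∸ᵥ u ≡ v
  u+ᵥv∸ᵥu≡v []       []       = ≡.refl
  u+ᵥv∸ᵥu≡v (x ∷ u) (y ∷ v) = ≡.cong₂ _∷_ (ℕₚ.m+n∸m≡n x y) (u+ᵥv∸ᵥu≡v u v)

  u+ᵥv≡0ᵥ⇒u≡0ᵥ : ∀ {n} (u v : Exp n) → u +ᵥ v ≡ 0ᵥ → u ≡ 0ᵥ
  u+ᵥv≡0ᵥ⇒u≡0ᵥ []       []       _  = ≡.refl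
  u+ᵥv≡0ᵥ⇒u≡0ᵥ (x ∷ u) (y ∷ v) eq =
    ≡.cong₂ _∷_ (ℕₚ.m+n≡0⇒m≡0 x (≡.cong Vec.head eq)) (u+ᵥv≡0ᵥ⇒u≡0ᵥ u v (≡.cong Vec.tail eq))

  lookup-+ᵥ : ∀ {n} (u v : Exp n) i → lookup (u +ᵥ v) i ≡ lookup u i + lookup v i
  lookup-+ᵥ u v i = Vec.lookup-zipWith _+_ i u v

  totalDeg-+ᵥ : ∀ {n} (u v : Exp n) → totalDeg (u +ᵥ v) ≡ totalDeg u + totalDeg v
  totalDeg-+ᵥ []       []       = ≡.refl
  totalDeg-+ᵥ (x ∷ u) (y ∷ v) = ≡.trans (≡.cong (x + y +_) (totalDeg-+ᵥ u v))
    (CommSemigroupProperties.interchange ℕₚ.+-commutativeSemigroup x y (totalDeg u) (totalDeg v))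

  totalDeg-split : ∀ {n} {u v w : Exp n} → u +ᵥ v ≡ w → totalDeg w ≡ totalDeg u + totalDeg v
  totalDeg-split {u = u} {v} ≡.refl = totalDeg-+ᵥ u v

  totalDeg-0ᵥ : ∀ n → totalDeg (0ᵥ {n}) ≡ 0
  totalDeg-0ᵥ zero    = ≡.refl
  totalDeg-0ᵥ (suc n) = totalDeg-0ᵥ n

  totalDeg≡0⇒≡0ᵥ : ∀ {n} (u : Exp n) → totalDeg u ≡ 0 → u ≡ 0ᵥ
  totalDeg≡0⇒≡0ᵥ []      _  = ≡.refl
  totalDeg≡0⇒≡0ᵥ (x ∷ u) eq =
    ≡.cong₂ _∷_ (ℕₚ.m+n≡0⇒m≡0 x eq) (totalDeg≡0⇒≡0ᵥ u (ℕₚ.m+n≡0⇒n≡0 x eq))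

  totalDeg<1⇒≡0ᵥ : ∀ {n} (u : Exp n) → totalDeg u < 1 → u ≡ 0ᵥ
  totalDeg<1⇒≡0ᵥ u (s≤s lt) = totalDeg≡0⇒≡0ᵥ u (ℕₚ.n≤0⇒n≡0 lt)

  ≢0ᵥ⇒totalDeg≥1 : ∀ {n} (u : Exp n) → u ≢ 0ᵥ → 1 ≤ totalDeg u
  ≢0ᵥ⇒totalDeg≥1 u u≢0 with totalDeg u in eq
  ... | zero  = ⊥-elim (u≢0 (totalDeg≡0⇒≡0ᵥ u eq))
  ... | suc _ = s≤s z≤n

  basis-zero : ∀ {n} (j : Fin n) → basis j 0 ≡ 0ᵥ
  basis-zero Fin.zero    = ≡.refl
  basis-zero (Fin.suc j) = ≡.cong (0 ∷_) (basis-zero j)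

  basis-+ : ∀ {n} (j : Fin n) s t → basis j s +ᵥ basis j t ≡ basis j (s + t)
  basis-+ Fin.zero    s t = ≡.cong (s + t ∷_) (+ᵥ-identityˡ 0ᵥ)
  basis-+ (Fin.suc j) s t = ≡.cong (0 ∷_) (basis-+ j s t)

  totalDeg-basis : ∀ {n} (j : Fin n) t → totalDeg (basis j t) ≡ t
  totalDeg-basis {suc n} Fin.zero    t = ≡.trans (≡.cong (t +_) (totalDeg-0ᵥ n)) (ℕₚ.+-identityʳ t)
  totalDeg-basis         (Fin.suc j) t = totalDeg-basis j t

  lookup-basis-≡ : ∀ {n} (j : Fin n) t → lookup (basis j t) j ≡ t
  lookup-basis-≡ j t = Vec.lookup∘update j 0ᵥ t

  lookup-basis-≢ : ∀ {n} {i j : Fin n} t → i ≢ j → lookup (basis j t) i ≡ 0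
  lookup-basis-≢ {i = i} t i≢j = ≡.trans (Vec.lookup∘update′ i≢j 0ᵥ t) (Vec.lookup-replicate i 0)

  basis-≢0ᵥ : ∀ {n} (j : Fin n) t → basis j (suc t) ≢ 0ᵥ
  basis-≢0ᵥ j t eq with ≡.trans (≡.sym (lookup-basis-≡ j (suc t)))
                          (≡.trans (≡.cong (λ v → lookup v j) eq) (Vec.lookup-replicate j 0))
  ... | ()

  PowerOf : ∀ {n} → Fin n → ℕ → Exp n → Set
  PowerOf j b β = ∃ λ t → t ≤ b × β ≡ basis j t

  totalDeg-PowerOf : ∀ {n} {j : Fin n} {b β} → PowerOf j b β → totalDeg β ≤ b
  totalDeg-PowerOf {j = j} (t , t≤b , ≡.refl) = ≡.subst (_≤ _) (≡.sym (totalDeg-basis j t)) t≤b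

module PowerProducts where
  open import Data.Nat using (_+_; _*_)
  open Exponents

  occurrences : ∀ {n k} → Fin n → Vec (Fin n) k → ℕ
  occurrences x = count (Fin._≟ x)

  removeFirst : ∀ {n k} → Fin n → Vec (Fin n) (suc k) → Vec (Fin n) k
  removeFirst j (i ∷ [])       = []
  removeFirst j (i ∷ i′ ∷ is) with i Fin.≟ j
  ... | yes _ = i′ ∷ is
  ... | no  _ = i ∷ removeFirst j (i′ ∷ is)

  occurrences-∷-≤ : ∀ {n k} (x i : Fin n) (v : Vec (Fin n) k) → occurrences x v ≤ occurrences x (i ∷ v)
  occurrences-∷-≤ x i v with i Fin.≟ x
  ... | yes _ = ℕₚ.n≤1+n _
  ... | no  _ = ℕₚ.≤-refl

  occurrences-∷-≢ : ∀ {n k} {i x : Fin n} (v : Vec (Fin n) k) → i ≢ x →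
                    occurrences x (i ∷ v) ≡ occurrences x v
  occurrences-∷-≢ {i = i} {x} v i≢x with i Fin.≟ x
  ... | yes i≡x = ⊥-elim (i≢x i≡x)
  ... | no  _   = ≡.refl

  occurrences-removeFirst-≤ : ∀ {n k} (x j : Fin n) (v : Vec (Fin n) (suc k)) →
                              occurrences x (removeFirst j v) ≤ occurrences x v
  occurrences-removeFirst-≤ x j (i ∷ [])       = z≤n
  occurrences-removeFirst-≤ x j (i ∷ i′ ∷ is) with i Fin.≟ j
  ... | yes _ = occurrences-∷-≤ x i (i′ ∷ is)
  ... | no  _ with i Fin.≟ x
  ...   | yes _ = s≤s (occurrences-removeFirst-≤ x j (i′ ∷ is))
  ...   | no  _ = occurrences-removeFirst-≤ x j (i′ ∷ is)

  occurrences-removeFirst-self : ∀ {n k} (j : Fin n) (v : Vec (Fin n) (suc k)) →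
                                 occurrences j (removeFirst j v) ≤ occurrences j v ∸ 1
  occurrences-removeFirst-self j (i ∷ [])       = z≤n
  occurrences-removeFirst-self j (i ∷ i′ ∷ is) with i Fin.≟ j
  ... | yes ≡.refl = ℕₚ.≤-refl
  ... | no  i≢j    = ≡.subst (_≤ occurrences j (i′ ∷ is) ∸ 1)
                       (≡.sym (occurrences-∷-≢ (removeFirst j (i′ ∷ is)) i≢j))
                       (occurrences-removeFirst-self j (i′ ∷ is))

  lookup-powProdExp : ∀ {n k} m (is : Vec (Fin n) k) x → lookup (powProdExp m is) x ≡ suc m * occurrences x is
  lookup-powProdExp m []       x = ≡.trans (Vec.lookup-replicate x 0) (≡.sym (ℕₚ.*-zeroʳ (suc m)))
  lookup-powProdExp m (i ∷ is) x with i Fin.≟ x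
  ... | yes ≡.refl = ≡.trans (Vec.lookup∘update i (powProdExp m is) _)
                       (≡.trans (≡.cong (suc m +_) (lookup-powProdExp m is i)) (≡.sym (ℕₚ.*-suc (suc m) _)))
  ... | no  i≢x    = ≡.trans (Vec.lookup∘update′ (i≢x ∘ ≡.sym) (powProdExp m is) _) (lookup-powProdExp m is x)

  s*c≤t+g⇒s*[c∸1]≤g : ∀ s c {t g} → s * c ≤ t + g → t ≤ s → s * (c ∸ 1) ≤ g
  s*c≤t+g⇒s*[c∸1]≤g s zero {g = g} _ _ = ≡.subst (_≤ g) (≡.sym (ℕₚ.*-zeroʳ s)) z≤n
  s*c≤t+g⇒s*[c∸1]≤g s (suc c) {t} {g} s*c≤ t≤s = ℕₚ.+-cancelˡ-≤ s _ _ (begin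
    s + s * c  ≡⟨ ℕₚ.*-suc s c ⟨
    s * suc c  ≤⟨ s*c≤ ⟩
    t + g      ≤⟨ ℕₚ.+-monoˡ-≤ g t≤s ⟩
    s + g      ∎)
    where open ℕₚ.≤-Reasoning

  -- Dividing by x_j^t with t ≤ m + 1 destroys at most one of the factors x_i^(m+1).
  powProdExp-removeFirst-∣ₘ : ∀ {n k} m (j : Fin n) (is : Vec (Fin n) (suc k)) {t} (γ : Exp n) →
                              t ≤ suc m → powProdExp m is ∣ₘ (basis j t +ᵥ γ) →
                              powProdExp m (removeFirst j is) ∣ₘ γ
  powProdExp-removeFirst-∣ₘ m j is {t} γ t≤1+m divides i = begin
    lookup (powProdExp m (removeFirst j is)) i  ≡⟨ lookup-powProdExp m (removeFirst j is) i ⟩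
    suc m * occurrences i (removeFirst j is)    ≤⟨ bound ⟩
    lookup γ i                                  ∎
    where
    open ℕₚ.≤-Reasoning
    dᵢ : suc m * occurrences i is ≤ lookup (basis j t) i + lookup γ i
    dᵢ = ≡.subst₂ _≤_ (lookup-powProdExp m is i) (lookup-+ᵥ (basis j t) γ i) (divides i)
    bound : suc m * occurrences i (removeFirst j is) ≤ lookup γ i
    bound with i Fin.≟ j
    ... | yes ≡.refl = ℕₚ.≤-trans (ℕₚ.*-monoʳ-≤ (suc m) (occurrences-removeFirst-self i is))
                         (s*c≤t+g⇒s*[c∸1]≤g (suc m) (occurrences i is)
                           (≡.subst (λ u → _ ≤ u + _) (lookup-basis-≡ i t) dᵢ) t≤1+m)
    ... | no  i≢j    = ℕₚ.≤-trans (ℕₚ.*-monoʳ-≤ (suc m) (occurrences-removeFirst-≤ i j is))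
                         (≡.subst (λ u → _ ≤ u + _) (lookup-basis-≢ t i≢j) dᵢ)

module Polynomials {c ℓ : Level} (R : CommutativeRing c ℓ) where
  open CommutativeRing R
  open import Data.Nat using () renaming (_+_ to _+ℕ_)
  open Poly R
  open Exponents
  open PowerProducts
  open SetoidReasoning setoid

  -- A term list p is read through its pairings ⟪ p , h ⟫ = Σ a · h β over its terms (a , β):
  -- coefficients, products and substitution all become identities between such sums, and
  -- two term lists are identified (_≈ₚ_) when they pair equally with every h.
  ⟪_,_⟫ : ∀ {n} → Pol n → (Exp n → Carrier) → Carrier
  ⟪ []            , h ⟫ = 0#
  ⟪ (a , β) ∷ p , h ⟫ = a * h β + ⟪ p , h ⟫

  ⟪⟫-cong : ∀ {n} (p : Pol n) {h h′ : Exp n → Carrier} → (∀ β → h β ≈ h′ β) → ⟪ p , h ⟫ ≈ ⟪ p , h′ ⟫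
  ⟪⟫-cong []            h≈h′ = refl
  ⟪⟫-cong ((a , β) ∷ p) h≈h′ = +-cong (*-cong refl (h≈h′ β)) (⟪⟫-cong p h≈h′)

  ⟪⟫-++ : ∀ {n} (p q : Pol n) h → ⟪ p List.++ q , h ⟫ ≈ ⟪ p , h ⟫ + ⟪ q , h ⟫
  ⟪⟫-++ []      q h = sym (+-identityˡ _)
  ⟪⟫-++ (_ ∷ p) q h = trans (+-cong refl (⟪⟫-++ p q h)) (sym (+-assoc _ _ _))

  ⟪⟫-zero : ∀ {n} (p : Pol n) {h : Exp n → Carrier} → (∀ β → h β ≈ 0#) → ⟪ p , h ⟫ ≈ 0#
  ⟪⟫-zero []            h≈0 = refl
  ⟪⟫-zero ((a , β) ∷ p) h≈0 =
    trans (+-cong (trans (*-cong refl (h≈0 β)) (zeroʳ a)) (⟪⟫-zero p h≈0)) (+-identityˡ _)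

  ⟪⟫-+ : ∀ {n} (p : Pol n) h h′ → ⟪ p , (λ β → h β + h′ β) ⟫ ≈ ⟪ p , h ⟫ + ⟪ p , h′ ⟫
  ⟪⟫-+ []            h h′ = sym (+-identityˡ _)
  ⟪⟫-+ ((a , β) ∷ p) h h′ = begin
    a * (h β + h′ β) + ⟪ p , (λ β → h β + h′ β) ⟫
      ≈⟨ +-cong (distribˡ a _ _) (⟪⟫-+ p h h′) ⟩
    (a * h β + a * h′ β) + (⟪ p , h ⟫ + ⟪ p , h′ ⟫)
      ≈⟨ CommSemigroupProperties.interchange +-commutativeSemigroup _ _ _ _ ⟩
    (a * h β + ⟪ p , h ⟫) + (a * h′ β + ⟪ p , h′ ⟫)
      ∎

  ⟪⟫-*ˡ : ∀ {n} (p : Pol n) x h → ⟪ p , (λ β → x * h β) ⟫ ≈ x * ⟪ p , h ⟫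
  ⟪⟫-*ˡ []            x h = sym (zeroʳ x)
  ⟪⟫-*ˡ ((a , β) ∷ p) x h = begin
    a * (x * h β) + ⟪ p , (λ β → x * h β) ⟫
      ≈⟨ +-cong (CommSemigroupProperties.x∙yz≈y∙xz *-commutativeSemigroup a x _) (⟪⟫-*ˡ p x h) ⟩
    x * (a * h β) + x * ⟪ p , h ⟫
      ≈⟨ distribˡ x _ _ ⟨
    x * (a * h β + ⟪ p , h ⟫)
      ∎

  ⟪⟫-swap : ∀ {n} (p q : Pol n) (H : Exp n → Exp n → Carrier) →
            ⟪ p , (λ β → ⟪ q , H β ⟫) ⟫ ≈ ⟪ q , (λ γ → ⟪ p , (λ β → H β γ) ⟫) ⟫
  ⟪⟫-swap []            q H = sym (⟪⟫-zero q (λ _ → refl))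
  ⟪⟫-swap ((a , β) ∷ p) q H = begin
    a * ⟪ q , H β ⟫ + ⟪ p , (λ β → ⟪ q , H β ⟫) ⟫
      ≈⟨ +-cong (sym (⟪⟫-*ˡ q a (H β))) (⟪⟫-swap p q H) ⟩
    ⟪ q , (λ γ → a * H β γ) ⟫ + ⟪ q , (λ γ → ⟪ p , (λ β → H β γ) ⟫) ⟫
      ≈⟨ ⟪⟫-+ q _ _ ⟨
    ⟪ q , (λ γ → a * H β γ + ⟪ p , (λ β → H β γ) ⟫) ⟫
      ∎

  -- The multiplier F is abstract so that the pattern lambda inside _⊗_ need not be restated.
  ⟪⟫-map : ∀ {n} a (β : Exp n) (F : Carrier × Exp n → Carrier × Exp n) →
           (∀ u → proj₁ (F u) ≡ a * proj₁ u) → (∀ u → proj₂ (F u) ≡ β +ᵥ proj₂ u) →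
           ∀ q h → ⟪ List.map F q , h ⟫ ≈ a * ⟪ q , (λ γ → h (β +ᵥ γ)) ⟫
  ⟪⟫-map a β F F₁ F₂ []      h = sym (zeroʳ a)
  ⟪⟫-map a β F F₁ F₂ (u ∷ q) h = begin
    proj₁ (F u) * h (proj₂ (F u)) + ⟪ List.map F q , h ⟫
      ≈⟨ +-cong (*-cong (reflexive (F₁ u)) (reflexive (≡.cong h (F₂ u)))) (⟪⟫-map a β F F₁ F₂ q h) ⟩
    (a * proj₁ u) * h (β +ᵥ proj₂ u) + a * ⟪ q , (λ γ → h (β +ᵥ γ)) ⟫
      ≈⟨ +-cong (*-assoc _ _ _) refl ⟩
    a * (proj₁ u * h (β +ᵥ proj₂ u)) + a * ⟪ q , (λ γ → h (β +ᵥ γ)) ⟫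
      ≈⟨ distribˡ a _ _ ⟨
    a * (proj₁ u * h (β +ᵥ proj₂ u) + ⟪ q , (λ γ → h (β +ᵥ γ)) ⟫)
      ∎

  ⟪⟫-⊗ : ∀ {n} (p q : Pol n) h → ⟪ p ⊗ q , h ⟫ ≈ ⟪ p , (λ β → ⟪ q , (λ γ → h (β +ᵥ γ)) ⟫) ⟫
  ⟪⟫-⊗ []            q h = refl
  ⟪⟫-⊗ ((a , β) ∷ p) q h = trans (⟪⟫-++ (List.map _ q) (p ⊗ q) h)
    (+-cong (⟪⟫-map a β _ (λ _ → ≡.refl) (λ _ → ≡.refl) q h) (⟪⟫-⊗ p q h))

  ⟪⟫-constP⊗ : ∀ {n} a (p : Pol n) h → ⟪ constP a ⊗ p , h ⟫ ≈ a * ⟪ p , h ⟫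
  ⟪⟫-constP⊗ a p h = begin
    ⟪ constP a ⊗ p , h ⟫                    ≈⟨ trans (⟪⟫-⊗ (constP a) p h) (+-identityʳ _) ⟩
    a * ⟪ p , (λ γ → h (0ᵥ +ᵥ γ)) ⟫         ≈⟨ *-cong refl (⟪⟫-cong p (λ γ → reflexive (≡.cong h (+ᵥ-identityˡ γ)))) ⟩
    a * ⟪ p , h ⟫                           ∎

  infix 4 _≈ₚ_
  record _≈ₚ_ {n} (p q : Pol n) : Set (c Level.⊔ ℓ) where
    constructor mk≈ₚ
    field pairing : ∀ h → ⟪ p , h ⟫ ≈ ⟪ q , h ⟫
  open _≈ₚ_

  ≈ₚ-refl : ∀ {n} {p : Pol n} → p ≈ₚ p
  ≈ₚ-refl = mk≈ₚ λ _ → refl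

  ≈ₚ-sym : ∀ {n} {p q : Pol n} → p ≈ₚ q → q ≈ₚ p
  ≈ₚ-sym p≈q = mk≈ₚ λ h → sym (pairing p≈q h)

  ≈ₚ-trans : ∀ {n} {p q r : Pol n} → p ≈ₚ q → q ≈ₚ r → p ≈ₚ r
  ≈ₚ-trans p≈q q≈r = mk≈ₚ λ h → trans (pairing p≈q h) (pairing q≈r h)

  ⊗-cong : ∀ {n} {p p′ q q′ : Pol n} → p ≈ₚ p′ → q ≈ₚ q′ → p ⊗ q ≈ₚ p′ ⊗ q′
  ⊗-cong {p = p} {p′} {q} {q′} p≈p′ q≈q′ = mk≈ₚ λ h → begin
    ⟪ p ⊗ q , h ⟫                                     ≈⟨ ⟪⟫-⊗ p q h ⟩
    ⟪ p , (λ β → ⟪ q , (λ γ → h (β +ᵥ γ)) ⟫) ⟫       ≈⟨ ⟪⟫-cong p (λ β → pairing q≈q′ _) ⟩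
    ⟪ p , (λ β → ⟪ q′ , (λ γ → h (β +ᵥ γ)) ⟫) ⟫      ≈⟨ pairing p≈p′ _ ⟩
    ⟪ p′ , (λ β → ⟪ q′ , (λ γ → h (β +ᵥ γ)) ⟫) ⟫     ≈⟨ ⟪⟫-⊗ p′ q′ h ⟨
    ⟪ p′ ⊗ q′ , h ⟫                                   ∎

  ⊗-comm : ∀ {n} (p q : Pol n) → p ⊗ q ≈ₚ q ⊗ p
  ⊗-comm p q = mk≈ₚ λ h → begin
    ⟪ p ⊗ q , h ⟫
      ≈⟨ ⟪⟫-⊗ p q h ⟩
    ⟪ p , (λ β → ⟪ q , (λ γ → h (β +ᵥ γ)) ⟫) ⟫
      ≈⟨ ⟪⟫-swap p q (λ β γ → h (β +ᵥ γ)) ⟩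
    ⟪ q , (λ γ → ⟪ p , (λ β → h (β +ᵥ γ)) ⟫) ⟫
      ≈⟨ ⟪⟫-cong q (λ γ → ⟪⟫-cong p (λ β → reflexive (≡.cong h (+ᵥ-comm β γ)))) ⟩
    ⟪ q , (λ γ → ⟪ p , (λ β → h (γ +ᵥ β)) ⟫) ⟫
      ≈⟨ ⟪⟫-⊗ q p h ⟨
    ⟪ q ⊗ p , h ⟫
      ∎

  ⊗-assoc : ∀ {n} (p q r : Pol n) → (p ⊗ q) ⊗ r ≈ₚ p ⊗ (q ⊗ r)
  ⊗-assoc p q r = mk≈ₚ λ h → begin
    ⟪ (p ⊗ q) ⊗ r , h ⟫
      ≈⟨ trans (⟪⟫-⊗ (p ⊗ q) r h) (⟪⟫-⊗ p q _) ⟩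
    ⟪ p , (λ β → ⟪ q , (λ γ → ⟪ r , (λ δ → h ((β +ᵥ γ) +ᵥ δ)) ⟫) ⟫) ⟫
      ≈⟨ ⟪⟫-cong p (λ β → ⟪⟫-cong q (λ γ → ⟪⟫-cong r (λ δ → reflexive (≡.cong h (+ᵥ-assoc β γ δ))))) ⟩
    ⟪ p , (λ β → ⟪ q , (λ γ → ⟪ r , (λ δ → h (β +ᵥ (γ +ᵥ δ))) ⟫) ⟫) ⟫
      ≈⟨ ⟪⟫-cong p (λ β → ⟪⟫-⊗ q r (λ ε → h (β +ᵥ ε))) ⟨
    ⟪ p , (λ β → ⟪ q ⊗ r , (λ ε → h (β +ᵥ ε)) ⟫) ⟫
      ≈⟨ ⟪⟫-⊗ p (q ⊗ r) h ⟨
    ⟪ p ⊗ (q ⊗ r) , h ⟫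
      ∎

  ⊗-identityˡ : ∀ {n} (p : Pol n) → constP 1# ⊗ p ≈ₚ p
  ⊗-identityˡ p = mk≈ₚ λ h → trans (⟪⟫-constP⊗ 1# p h) (*-identityˡ _)

  ⊗-isCommutativeSemigroup : ∀ n → IsCommutativeSemigroup (_≈ₚ_ {n}) _⊗_
  ⊗-isCommutativeSemigroup n = record
    { isSemigroup = record
      { isMagma = record
        { isEquivalence = record { refl = ≈ₚ-refl ; sym = ≈ₚ-sym ; trans = ≈ₚ-trans }
        ; ∙-cong        = ⊗-cong
        }
      ; assoc = ⊗-assoc
      }
    ; comm = ⊗-comm
    }

  ⊗-commutativeSemigroup : ℕ → CommutativeSemigroup c (c Level.⊔ ℓ)
  ⊗-commutativeSemigroup n = record { isCommutativeSemigroup = ⊗-isCommutativeSemigroup n }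

  powP-+ : ∀ {n} (g : Pol n) d e → powP g (d +ℕ e) ≈ₚ powP g d ⊗ powP g e
  powP-+ g zero    e = ≈ₚ-sym (⊗-identityˡ (powP g e))
  powP-+ g (suc d) e =
    ≈ₚ-trans (⊗-cong (≈ₚ-refl {p = g}) (powP-+ g d e)) (≈ₚ-sym (⊗-assoc g (powP g d) (powP g e)))

  monSubst-+ᵥ : ∀ {n k} (gs : Vec (Pol n) k) β γ → monSubst gs (β +ᵥ γ) ≈ₚ monSubst gs β ⊗ monSubst gs γ
  monSubst-+ᵥ []       []      []      = ≈ₚ-sym (⊗-identityˡ (constP 1#))
  monSubst-+ᵥ {n} (g ∷ gs) (d ∷ β) (e ∷ γ) =
    ≈ₚ-trans (⊗-cong (powP-+ g d e) (monSubst-+ᵥ gs β γ))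
             (CommSemigroupProperties.interchange (⊗-commutativeSemigroup n)
               (powP g d) (powP g e) (monSubst gs β) (monSubst gs γ))

  ⟪⟫-substP : ∀ {n} (p : Pol n) gs h → ⟪ substP p gs , h ⟫ ≈ ⟪ p , (λ α → ⟪ monSubst gs α , h ⟫) ⟫
  ⟪⟫-substP []            gs h = refl
  ⟪⟫-substP ((a , α) ∷ p) gs h =
    trans (⟪⟫-++ (constP a ⊗ monSubst gs α) (substP p gs) h)
          (+-cong (⟪⟫-constP⊗ a (monSubst gs α) h) (⟪⟫-substP p gs h))

  substP-⊗ : ∀ {n} (p q : Pol n) gs → substP (p ⊗ q) gs ≈ₚ substP p gs ⊗ substP q gs
  substP-⊗ p q gs = mk≈ₚ λ h → begin
    ⟪ substP (p ⊗ q) gs , h ⟫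
      ≈⟨ trans (⟪⟫-substP (p ⊗ q) gs h) (⟪⟫-⊗ p q _) ⟩
    ⟪ p , (λ β → ⟪ q , (λ γ → ⟪ monSubst gs (β +ᵥ γ) , h ⟫) ⟫) ⟫
      ≈⟨ ⟪⟫-cong p (λ β → ⟪⟫-cong q (λ γ →
           trans (pairing (monSubst-+ᵥ gs β γ) h) (⟪⟫-⊗ (monSubst gs β) _ h))) ⟩
    ⟪ p , (λ β → ⟪ q , (λ γ → ⟪ monSubst gs β , (λ β′ → ⟪ monSubst gs γ , (λ γ′ → h (β′ +ᵥ γ′)) ⟫) ⟫) ⟫) ⟫
      ≈⟨ ⟪⟫-cong p (λ β → ⟪⟫-swap (monSubst gs β) q _) ⟨
    ⟪ p , (λ β → ⟪ monSubst gs β , (λ β′ → ⟪ q , (λ γ → ⟪ monSubst gs γ , (λ γ′ → h (β′ +ᵥ γ′)) ⟫) ⟫) ⟫) ⟫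
      ≈⟨ ⟪⟫-cong p (λ β → ⟪⟫-cong (monSubst gs β) (λ β′ → ⟪⟫-substP q gs _)) ⟨
    ⟪ p , (λ β → ⟪ monSubst gs β , (λ β′ → ⟪ substP q gs , (λ γ′ → h (β′ +ᵥ γ′)) ⟫) ⟫) ⟫
      ≈⟨ trans (⟪⟫-⊗ (substP p gs) (substP q gs) h) (⟪⟫-substP p gs _) ⟨
    ⟪ substP p gs ⊗ substP q gs , h ⟫
      ∎

  δ : ∀ {n} → Exp n → Exp n → Carrier
  δ α β with β ≟ᵥ α
  ... | yes _ = 1#
  ... | no  _ = 0#

  δ-refl : ∀ {n} (α : Exp n) → δ α α ≈ 1#
  δ-refl α with α ≟ᵥ α
  ... | yes _   = refl
  ... | no  α≢α = ⊥-elim (α≢α ≡.refl)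

  δ-≢ : ∀ {n} {α β : Exp n} → β ≢ α → δ α β ≈ 0#
  δ-≢ {α = α} {β} β≢α with β ≟ᵥ α
  ... | yes β≡α = ⊥-elim (β≢α β≡α)
  ... | no  _   = refl

  coeff≈⟪δ⟫ : ∀ {n} (p : Pol n) α → coeff p α ≈ ⟪ p , δ α ⟫
  coeff≈⟪δ⟫ []            α = refl
  coeff≈⟪δ⟫ ((a , β) ∷ p) α with β ≟ᵥ α
  ... | yes _ = +-cong (sym (*-identityʳ a)) (coeff≈⟪δ⟫ p α)
  ... | no  _ = trans (coeff≈⟪δ⟫ p α) (sym (trans (+-cong (zeroʳ a) refl) (+-identityˡ _)))

  -- ⟪ p , (λ γ → δ α (β +ᵥ γ)) ⟫ is the coefficient of x^α in x^β · p.
  ⟪⟫-δ-+ᵥ-zero : ∀ {n} (p : Pol n) α β → (∀ γ → β +ᵥ γ ≡ α → coeff p γ ≈ 0#) →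
                 ⟪ p , (λ γ → δ α (β +ᵥ γ)) ⟫ ≈ 0#
  ⟪⟫-δ-+ᵥ-zero p α β vanish with β +ᵥ (α ∸ᵥ β) ≟ᵥ α
  ... | yes β+[α∸β]≡α = begin
    ⟪ p , (λ γ → δ α (β +ᵥ γ)) ⟫  ≈⟨ ⟪⟫-cong p δ-translate ⟩
    ⟪ p , δ (α ∸ᵥ β) ⟫            ≈⟨ coeff≈⟪δ⟫ p (α ∸ᵥ β) ⟨
    coeff p (α ∸ᵥ β)              ≈⟨ vanish (α ∸ᵥ β) β+[α∸β]≡α ⟩
    0#                            ∎
    where
    δ-translate : ∀ γ → δ α (β +ᵥ γ) ≈ δ (α ∸ᵥ β) γ
    δ-translate γ with β +ᵥ γ ≟ᵥ α | γ ≟ᵥ α ∸ᵥ β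
    ... | yes _     | yes _      = refl
    ... | no  _     | no  _      = refl
    ... | yes β+γ≡α | no γ≢α∸β   =
      ⊥-elim (γ≢α∸β (≡.trans (≡.sym (u+ᵥv∸ᵥu≡v β γ)) (≡.cong (_∸ᵥ β) β+γ≡α)))
    ... | no  β+γ≢α | yes ≡.refl = ⊥-elim (β+γ≢α β+[α∸β]≡α)
  ... | no β+[α∸β]≢α = ⟪⟫-zero p (λ γ → δ-≢ (λ β+γ≡α → β+[α∸β]≢α
          (≡.subst (λ u → β +ᵥ (u ∸ᵥ β) ≡ α) β+γ≡α (≡.trans (≡.cong (β +ᵥ_) (u+ᵥv∸ᵥu≡v β γ)) β+γ≡α))))

  Supported : ∀ {n} → (Exp n → Set) → Pol n → Set c
  Supported Q = All (Q ∘ proj₂)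

  ⟪⟫-supported-zero : ∀ {n} {Q : Exp n → Set} {p : Pol n} {h} →
                      Supported Q p → (∀ β → Q β → h β ≈ 0#) → ⟪ p , h ⟫ ≈ 0#
  ⟪⟫-supported-zero []                   _   = refl
  ⟪⟫-supported-zero {p = (a , β) ∷ _} (Qβ ∷ supp) h≈0 =
    trans (+-cong (trans (*-cong refl (h≈0 β Qβ)) (zeroʳ a)) (⟪⟫-supported-zero supp h≈0)) (+-identityˡ _)

  Supported-⊗ : ∀ {n} {Q₁ Q₂ Q : Exp n → Set} {p q : Pol n} → (∀ {β γ} → Q₁ β → Q₂ γ → Q (β +ᵥ γ)) →
                Supported Q₁ p → Supported Q₂ q → Supported Q (p ⊗ q)
  Supported-⊗ combine supp₁ supp₂ =
    All.concat⁺ (All.map⁺ (All.map (λ Q₁β → All.map⁺ (All.map (combine Q₁β) supp₂)) supp₁))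

  coeff-⊗-zero : ∀ {n} {Q : Exp n → Set} (F P : Pol n) α → Supported Q F →
                 (∀ β → Q β → ∀ γ → β +ᵥ γ ≡ α → coeff P γ ≈ 0#) → coeff (F ⊗ P) α ≈ 0#
  coeff-⊗-zero F P α supp vanish = begin
    coeff (F ⊗ P) α                                ≈⟨ coeff≈⟪δ⟫ (F ⊗ P) α ⟩
    ⟪ F ⊗ P , δ α ⟫                                ≈⟨ ⟪⟫-⊗ F P (δ α) ⟩
    ⟪ F , (λ β → ⟪ P , (λ γ → δ α (β +ᵥ γ)) ⟫) ⟫  ≈⟨ ⟪⟫-supported-zero supp (λ β Qβ → ⟪⟫-δ-+ᵥ-zero P α β (vanish β Qβ)) ⟩
    0#                                             ∎

  constTerm : ∀ {n} → Pol n → Carrier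
  constTerm p = ⟪ p , δ 0ᵥ ⟫

  ⟪⟫-concentrated : ∀ {n} (p : Pol n) (f : Exp n → Carrier) → (∀ β → β ≢ 0ᵥ → f β ≈ 0#) →
                    ⟪ p , f ⟫ ≈ f 0ᵥ * constTerm p
  ⟪⟫-concentrated p f f≈0 = trans (⟪⟫-cong p f≈f0δ) (⟪⟫-*ˡ p (f 0ᵥ) (δ 0ᵥ))
    where
    f≈f0δ : ∀ β → f β ≈ f 0ᵥ * δ 0ᵥ β
    f≈f0δ β with β ≟ᵥ 0ᵥ
    ... | yes ≡.refl = sym (*-identityʳ _)
    ... | no  β≢0    = trans (f≈0 β β≢0) (sym (zeroʳ _))

  constTerm-⊗ : ∀ {n} (p q : Pol n) → constTerm (p ⊗ q) ≈ constTerm p * constTerm q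
  constTerm-⊗ p q = begin
    constTerm (p ⊗ q)
      ≈⟨ ⟪⟫-⊗ p q (δ 0ᵥ) ⟩
    ⟪ p , (λ β → ⟪ q , (λ γ → δ 0ᵥ (β +ᵥ γ)) ⟫) ⟫
      ≈⟨ ⟪⟫-concentrated p _ off-0ᵥ ⟩
    ⟪ q , (λ γ → δ 0ᵥ (0ᵥ +ᵥ γ)) ⟫ * constTerm p
      ≈⟨ *-cong (⟪⟫-cong q (λ γ → reflexive (≡.cong (δ 0ᵥ) (+ᵥ-identityˡ γ)))) refl ⟩
    constTerm q * constTerm p
      ≈⟨ *-comm _ _ ⟩
    constTerm p * constTerm q
      ∎
    where
    off-0ᵥ : ∀ β → β ≢ 0ᵥ → ⟪ q , (λ γ → δ 0ᵥ (β +ᵥ γ)) ⟫ ≈ 0#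
    off-0ᵥ β β≢0 = ⟪⟫-zero q (λ γ → δ-≢ (β≢0 ∘ u+ᵥv≡0ᵥ⇒u≡0ᵥ β γ))

  constTerm-constP : ∀ {n} a → constTerm {n} (constP a) ≈ a
  constTerm-constP {n} a = trans (+-identityʳ _) (trans (*-cong refl (δ-refl {n} 0ᵥ)) (*-identityʳ a))

  constTerm-varP : ∀ {n} (j : Fin n) → constTerm (varP j) ≈ 0#
  constTerm-varP j = trans (+-identityʳ _) (trans (*-cong refl (δ-≢ (basis-≢0ᵥ j 0))) (zeroʳ _))

  constTerm-monSubst-0ᵥ : ∀ {n k} (gs : Vec (Pol n) k) → constTerm (monSubst gs 0ᵥ) ≈ 1#
  constTerm-monSubst-0ᵥ {n} []       = constTerm-constP {n} 1#
  constTerm-monSubst-0ᵥ {n} (g ∷ gs) = begin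
    constTerm (constP 1# ⊗ monSubst gs 0ᵥ)                   ≈⟨ constTerm-⊗ (constP 1#) (monSubst gs 0ᵥ) ⟩
    constTerm {n} (constP 1#) * constTerm (monSubst gs 0ᵥ)   ≈⟨ *-cong (constTerm-constP {n} 1#) (constTerm-monSubst-0ᵥ gs) ⟩
    1# * 1#                                                  ≈⟨ *-identityˡ 1# ⟩
    1#                                                       ∎

  constTerm-monSubst-basis : ∀ {n k} (gs : Vec (Pol n) k) j →
                             constTerm (monSubst gs (basis j 1)) ≈ constTerm (lookup gs j)
  constTerm-monSubst-basis {n} (g ∷ gs) Fin.zero = begin
    constTerm ((g ⊗ constP 1#) ⊗ monSubst gs 0ᵥ)
      ≈⟨ trans (constTerm-⊗ (g ⊗ constP 1#) (monSubst gs 0ᵥ))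
               (*-cong (constTerm-⊗ g (constP 1#)) (constTerm-monSubst-0ᵥ gs)) ⟩
    (constTerm g * constTerm {n} (constP 1#)) * 1#
      ≈⟨ trans (*-identityʳ _) (*-cong refl (constTerm-constP {n} 1#)) ⟩
    constTerm g * 1#
      ≈⟨ *-identityʳ _ ⟩
    constTerm g
      ∎
  constTerm-monSubst-basis {n} (g ∷ gs) (Fin.suc j) = begin
    constTerm (constP 1# ⊗ monSubst gs (basis j 1))
      ≈⟨ constTerm-⊗ (constP 1#) (monSubst gs (basis j 1)) ⟩
    constTerm {n} (constP 1#) * constTerm (monSubst gs (basis j 1))
      ≈⟨ *-cong (constTerm-constP {n} 1#) (constTerm-monSubst-basis gs j) ⟩
    1# * constTerm (lookup gs j)
      ≈⟨ *-identityˡ _ ⟩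
    constTerm (lookup gs j)
      ∎

  shiftVars : ∀ {n} → Vec ℕ n → Vec (Pol n) n
  shiftVars a = tabulate (λ i → varP i ⊕ constP (fromℕ (lookup a i)))

  constTerm-shiftVars : ∀ {n} (a : Vec ℕ n) j → constTerm (monSubst (shiftVars a) (basis j 1)) ≈ fromℕ (lookup a j)
  constTerm-shiftVars {n} a j = begin
    constTerm (monSubst (shiftVars a) (basis j 1))
      ≈⟨ constTerm-monSubst-basis (shiftVars a) j ⟩
    constTerm (lookup (shiftVars a) j)
      ≡⟨ ≡.cong constTerm (Vec.lookup∘tabulate _ j) ⟩
    constTerm (varP j ⊕ constP (fromℕ (lookup a j)))
      ≈⟨ ⟪⟫-++ (varP j) (constP (fromℕ (lookup a j))) (δ 0ᵥ) ⟩
    constTerm (varP j) + constTerm {n} (constP (fromℕ (lookup a j)))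
      ≈⟨ trans (+-cong (constTerm-varP j) (constTerm-constP {n} _)) (+-identityˡ _) ⟩
    fromℕ (lookup a j)
      ∎

  constTerm-shiftP-linear : ∀ {n} (a : Vec ℕ n) j b →
                            constTerm (shiftP (varP j ⊕ constP b) a) ≈ fromℕ (lookup a j) + b
  constTerm-shiftP-linear a j b = trans (⟪⟫-substP (varP j ⊕ constP b) (shiftVars a) (δ 0ᵥ))
    (+-cong (trans (*-identityˡ _) (constTerm-shiftVars a j))
            (trans (+-identityʳ _) (trans (*-cong refl (constTerm-monSubst-0ᵥ (shiftVars a))) (*-identityʳ b))))

  constTerm-shiftP-fallingP : ∀ {n} m (j : Fin n) a → lookup a j ≤ m → constTerm (shiftP (fallingP m j) a) ≈ 0#
  constTerm-shiftP-fallingP zero j a aⱼ≤0 =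
    trans (⟪⟫-substP (varP j) (shiftVars a) (δ 0ᵥ))
      (trans (+-identityʳ _) (trans (*-identityˡ _)
        (trans (constTerm-shiftVars a j) (reflexive (≡.cong fromℕ (ℕₚ.n≤0⇒n≡0 aⱼ≤0))))))
  constTerm-shiftP-fallingP (suc m) j a aⱼ≤1+m = begin
    constTerm (shiftP (fallingP m j ⊗ root) a)
      ≈⟨ pairing (substP-⊗ (fallingP m j) root (shiftVars a)) (δ 0ᵥ) ⟩
    constTerm (shiftP (fallingP m j) a ⊗ shiftP root a)
      ≈⟨ constTerm-⊗ (shiftP (fallingP m j) a) (shiftP root a) ⟩
    constTerm (shiftP (fallingP m j) a) * constTerm (shiftP root a)
      ≈⟨ *-cong refl (constTerm-shiftP-linear a j _) ⟩
    constTerm (shiftP (fallingP m j) a) * (fromℕ (lookup a j) + - fromℕ (suc m))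
      ≈⟨ vanishing-factor (ℕₚ.m≤n⇒m<n∨m≡n aⱼ≤1+m) ⟩
    0#
      ∎
    where
    root : Pol _
    root = varP j ⊕ constP (- fromℕ (suc m))
    vanishing-factor : lookup a j < suc m ⊎ lookup a j ≡ suc m →
                       constTerm (shiftP (fallingP m j) a) * (fromℕ (lookup a j) + - fromℕ (suc m)) ≈ 0#
    vanishing-factor (inj₁ aⱼ<1+m) =
      trans (*-cong (constTerm-shiftP-fallingP m j a (ℕₚ.≤-pred aⱼ<1+m)) refl) (zeroˡ _)
    vanishing-factor (inj₂ aⱼ≡1+m) =
      trans (*-cong refl (trans (+-cong (reflexive (≡.cong fromℕ aⱼ≡1+m)) refl) (-‿inverseʳ _))) (zeroʳ _)

  fallingP-supported : ∀ {n} m (j : Fin n) → Supported (PowerOf j (suc m)) (fallingP m j)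
  fallingP-supported zero    j = (1 , ℕₚ.≤-refl , ≡.refl) ∷ []
  fallingP-supported (suc m) j = Supported-⊗ combine (fallingP-supported m j)
    ((1 , ℕₚ.≤-refl , ≡.refl) ∷ (0 , z≤n , ≡.sym (basis-zero j)) ∷ [])
    where
    combine : ∀ {β γ} → PowerOf j (suc m) β → PowerOf j 1 γ → PowerOf j (suc (suc m)) (β +ᵥ γ)
    combine (t , t≤1+m , ≡.refl) (s , s≤1 , ≡.refl) =
      t +ℕ s , ℕₚ.≤-trans (ℕₚ.+-mono-≤ t≤1+m s≤1) (ℕₚ.≤-reflexive (ℕₚ.+-comm (suc m) 1)) , basis-+ j t s

  DegAtMost-⊗ : ∀ {n d D} (F P : Pol n) → Supported (λ β → totalDeg β ≤ d) F →
                DegAtMost D P → DegAtMost (d +ℕ D) (F ⊗ P)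
  DegAtMost-⊗ {d = d} {D} F P supp degP α d+D<|α| = coeff-⊗-zero F P α supp λ β |β|≤d γ β+γ≡α →
    degP γ (ℕₚ.+-cancelˡ-< d D (totalDeg γ) (ℕₚ.<-≤-trans d+D<|α|
      (ℕₚ.≤-trans (ℕₚ.≤-reflexive (totalDeg-split β+γ≡α)) (ℕₚ.+-monoˡ-≤ (totalDeg γ) |β|≤d))))

  NoPowerProducts : ∀ {n} → ℕ → ℕ → Pol n → Set ℓ
  NoPowerProducts {n} m k P = ∀ α (is : Vec (Fin n) k) → powProdExp m is ∣ₘ α → coeff P α ≈ 0#

  NoPowerProducts-⊗ : ∀ {n m k} {j : Fin n} (F P : Pol n) → Supported (PowerOf j (suc m)) F →
                      NoPowerProducts m k P → NoPowerProducts m (suc k) (F ⊗ P)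
  NoPowerProducts-⊗ {m = m} {j = j} F P supp noP α is divides = coeff-⊗-zero F P α supp
    λ { _ (t , t≤1+m , ≡.refl) γ ≡.refl →
          noP γ (removeFirst j is) (powProdExp-removeFirst-∣ₘ m j is γ t≤1+m divides) }

  MultAtLeast-⊗ : ∀ {n k} (F P : Pol n) a → MultAtLeast 1 F a → MultAtLeast k P a → MultAtLeast (suc k) (F ⊗ P) a
  MultAtLeast-⊗ {n} {k} F P a multF multP α |α|<1+k = begin
    coeff (shiftP (F ⊗ P) a) α       ≈⟨ coeff≈⟪δ⟫ (shiftP (F ⊗ P) a) α ⟩
    ⟪ shiftP (F ⊗ P) a , δ α ⟫       ≈⟨ pairing (substP-⊗ F P (shiftVars a)) (δ α) ⟩
    ⟪ X ⊗ Y , δ α ⟫                  ≈⟨ ⟪⟫-⊗ X Y (δ α) ⟩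
    ⟪ X , f ⟫                        ≈⟨ ⟪⟫-concentrated X f f-off-0ᵥ ⟩
    f 0ᵥ * constTerm X               ≈⟨ *-cong refl X-root ⟩
    f 0ᵥ * 0#                        ≈⟨ zeroʳ _ ⟩
    0#                               ∎
    where
    X = shiftP F a
    Y = shiftP P a
    f : Exp n → Carrier
    f β = ⟪ Y , (λ γ → δ α (β +ᵥ γ)) ⟫
    X-root : constTerm X ≈ 0#
    X-root = trans (sym (coeff≈⟪δ⟫ X 0ᵥ)) (multF 0ᵥ (s≤s (ℕₚ.≤-reflexive (totalDeg-0ᵥ n))))
    f-off-0ᵥ : ∀ β → β ≢ 0ᵥ → f β ≈ 0#
    f-off-0ᵥ β β≢0 = ⟪⟫-δ-+ᵥ-zero Y α β λ γ β+γ≡α → multP γ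
      (ℕₚ.≤-trans (ℕₚ.+-monoˡ-≤ (totalDeg γ) (≢0ᵥ⇒totalDeg≥1 β β≢0))
                  (ℕₚ.≤-pred (≡.subst (_< suc k) (totalDeg-split β+γ≡α) |α|<1+k)))

  fallingP-MultAtLeast-1 : ∀ {n} m (j : Fin n) a → lookup a j ≤ m → MultAtLeast 1 (fallingP m j) a
  fallingP-MultAtLeast-1 m j a aⱼ≤m α |α|<1 with totalDeg<1⇒≡0ᵥ α |α|<1
  ... | ≡.refl = trans (coeff≈⟪δ⟫ (shiftP (fallingP m j) a) 0ᵥ) (constTerm-shiftP-fallingP m j a aⱼ≤m)

module _ where
  open import Data.Nat using (_+_; _*_)

  private
    bound₁ : ∀ m n k → m * n + suc m * suc k ≡ suc (m * n + k + m * suc k)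
    bound₁ = solve-∀

    bound₂ : ∀ m n k → m * n + suc m * suc (suc k) ≡ suc (suc m + (m * n + k + m * suc k))
    bound₂ = solve-∀

  degreeBound-suc : ∀ m n k → m * n + suc m * suc (suc k) ∸ 1 ≡ suc m + (m * n + suc m * suc k ∸ 1)
  degreeBound-suc m n k rewrite bound₁ m n k | bound₂ m n k = ≡.refl

lemma4p2 : {c ℓ : Level} (R : CommutativeRing c ℓ) (m n k : ℕ) →
           1 ≤ m → 1 ≤ n → 3 ≤ k → (j : Fin n) → (P : Poly.Pol R n) →
           Poly.InU R m (k ∸ 1) P → Poly.InU R m k (Poly._⊗_ R (Poly.fallingP R m j) P)
lemma4p2 R m n (suc (suc (suc k))) _ _ (s≤s (s≤s (s≤s _))) j P ((degP , noPowP) , multP) =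
  (degree , NoPowerProducts-⊗ (fallingP m j) P (fallingP-supported m j) noPowP) ,
  λ a a∈grid → MultAtLeast-⊗ (fallingP m j) P a (fallingP-MultAtLeast-1 m j a (proj₁ a∈grid j)) (multP a a∈grid)
  where
  open Poly R
  open Polynomials R
  open Exponents
  open import Data.Nat using (_+_; _*_)
  degree : DegAtMost (m * n + suc m * suc (suc k) ∸ 1) (fallingP m j ⊗ P)
  degree = ≡.subst (λ D → DegAtMost D (fallingP m j ⊗ P)) (≡.sym (degreeBound-suc m n k))
                   (DegAtMost-⊗ (fallingP m j) P (All.map totalDeg-PowerOf (fallingP-supported m j)) degP)
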